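{- Let $n$ be odd, $r=\sum_{i=0}^\frac{n-1}2q^{2i}$ and $s=\sum_{i=1}^\frac{n-1}2q^{2i-1}$. If $L$ is the inverse of $x^{q^{n-1}}+ax$ for some $a\in\mathbb F_{q^n}^*$ with $\prod_{i=0}^{n-1}(-a)^{q^i}\ne1$, then the inverse of $\frac{L(x)}{x^{q+1}}$ as a permutation polynomial of $\mathbb F_{q^n}$ is $\frac{\ell(x^s)}{x^r}$, where $\ell$ is the inverse of $x^{q^{n-1}}+ax^q$.
   Context: $q$ is a prime power and $\mathbb F_{q^n}$ the finite field of order $q^n$. "Inverse" means compositional inverse of a permutation polynomial of $\mathbb F_{q^n}$. Polynomials are viewed as maps on $\mathbb F_{q^n}$ (so $x^{q^n}=x$), and $\frac1x$ (or $x^{ -1}$) denotes $x^{q^n-2}$, not a fraction. -}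

module Defs where

open import Data.Nat as ℕ using (ℕ; zero; suc; _∸_)
open import Data.Fin using (Fin)
open import Data.Product using (∃; _×_)
open import Relation.Binary.PropositionalEquality using (_≡_; _≢_)
open import Algebra.Structures using (IsCommutativeRing)
open import Function.Bundles using (_↔_)

record FiniteField (q n : ℕ) : Set₁ where
  infixl 6 _+_
  infixl 7 _*_
  field
    Carrier : Set
    _+_ _*_ : Carrier → Carrier → Carrier
    -_ : Carrier → Carrier
    0# 1# : Carrier
    isCommutativeRing : IsCommutativeRing _≡_ _+_ _*_ -_ 0# 1#
    0≢1 : 0# ≢ 1#
    hasInverse : ∀ x → x ≢ 0# → ∃ λ y → x * y ≡ 1#
    enumeration : Fin (q ℕ.^ n) ↔ Carrier

  pow : Carrier → ℕ → Carrier
  pow x zero = 1#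
  pow x (suc k) = x * pow x k

  inv : Carrier → Carrier
  inv x = pow x (q ℕ.^ n ∸ 2)

  prodF : ℕ → (ℕ → Carrier) → Carrier
  prodF zero f = 1#
  prodF (suc k) f = prodF k f * f k

sumℕ : ℕ → (ℕ → ℕ) → ℕ
sumℕ zero f = 0
sumℕ (suc k) f = sumℕ k f ℕ.+ f k

IsInverseOf : {A : Set} → (A → A) → (A → A) → Set
IsInverseOf g f = (∀ x → g (f x) ≡ x) × (∀ x → f (g x) ≡ x)

-- With N = q^n, Q = q^(n-1), φ z = z^Q + a z and ψ w = w^Q + a w^q, the exponents satisfy
-- q r = s + N and q s + 1 = r. For x ≠ 0 put c = 1/x and d = c^(r+s); then d^q = d,
-- x c^((q+1) r) = d, c^((q+1) s) = d x and d x^s = c^r. Since z ↦ z^q is multiplicative and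
-- bijective, every d with d^q = d satisfies
--   ψ (z^r d) = z^s d φ(z)   and   φ (w^(q+1) d) = w d ψ(w),
-- and substituting z = L(x), w = ℓ(x^s) yields both compositions at x ≠ 0; both maps fix 0.
-- The hypotheses a ≠ 0 and ∏ (-a)^(q^i) ≠ 1 only serve to rule out 𝔽₂, where 1/x = x^0 is not an
-- inverse.
module Submission where

open import Defs
open import Data.Nat as ℕ using (ℕ; zero; suc; _∸_; _^_; _≤_; _/_; NonZero)
open import Data.Nat.Primality using (Prime)
open import Data.Nat.DivMod using (m*n/n≡m)
import Data.Nat.Properties as ℕ
open import Data.Nat.Tactic.RingSolver as ℕ-Solver using ()
open import Data.Fin as Fin using (Fin)
open import Data.Fin.Properties as Fin using ()
open import Data.Fin.Permutation using (Permutation; _⟨$⟩ʳ_)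
open import Data.Product using (∃; _,_; proj₁; proj₂)
open import Data.Sum using (_⊎_; inj₁; inj₂)
open import Data.Empty using (⊥-elim)
open import Function using (_∘_)
open import Function.Bundles using (_↔_; Inverse; Injection; mk↔ₛ′)
open import Function.Properties.Inverse using (↔⇒↣)
open import Function.Construct.Composition using (_↔-∘_)
open import Function.Construct.Symmetry using (↔-sym)
open import Relation.Binary.PropositionalEquality
open import Relation.Nullary using (Dec; yes; no)
open import Algebra.Bundles using (CommutativeRing)
open import Algebra.Structures using (IsCommutativeRing)

half-double : ∀ m → (2 ℕ.* m) / 2 ≡ m
half-double m = trans (cong (_/ 2) (ℕ.*-comm 2 m)) (m*n/n≡m m 2)

module _ (q : ℕ) where

  evenPowerSum oddPowerSum : ℕ → ℕ
  evenPowerSum j = sumℕ (suc j) (λ i → q ^ (2 ℕ.* i))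
  oddPowerSum j = sumℕ j (λ i → q ^ (2 ℕ.* i ℕ.+ 1))

  q*evenPowerSum : ∀ j → q ℕ.* evenPowerSum j ≡ oddPowerSum j ℕ.+ q ^ suc (2 ℕ.* j)
  q*evenPowerSum zero = refl
  q*evenPowerSum (suc j) = begin
    q ℕ.* (evenPowerSum j ℕ.+ t)                     ≡⟨ ℕ.*-distribˡ-+ q (evenPowerSum j) t ⟩
    q ℕ.* evenPowerSum j ℕ.+ q ℕ.* t                 ≡⟨ cong (ℕ._+ q ℕ.* t) (q*evenPowerSum j) ⟩
    oddPowerSum j ℕ.+ q ^ (1 ℕ.+ 2 ℕ.* j) ℕ.+ q ℕ.* t ≡⟨ cong (λ e → oddPowerSum j ℕ.+ q ^ e ℕ.+ q ℕ.* t) (ℕ.+-comm 1 (2 ℕ.* j)) ⟩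
    oddPowerSum (suc j) ℕ.+ q ^ suc (2 ℕ.* suc j)     ∎
    where
    open ≡-Reasoning
    t : ℕ
    t = q ^ (2 ℕ.* suc j)

  q*oddPowerSum+1 : ∀ j → q ℕ.* oddPowerSum j ℕ.+ 1 ≡ evenPowerSum j
  q*oddPowerSum+1 zero = cong (ℕ._+ 1) (ℕ.*-zeroʳ q)
  q*oddPowerSum+1 (suc j) = begin
    q ℕ.* (oddPowerSum j ℕ.+ q ^ (2 ℕ.* j ℕ.+ 1)) ℕ.+ 1 ≡⟨ cong (λ e → q ℕ.* (oddPowerSum j ℕ.+ q ^ e) ℕ.+ 1) (ℕ.+-comm (2 ℕ.* j) 1) ⟩
    q ℕ.* (oddPowerSum j ℕ.+ t) ℕ.+ 1                   ≡⟨ regroup q (oddPowerSum j) t ⟩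
    (q ℕ.* oddPowerSum j ℕ.+ 1) ℕ.+ q ℕ.* t             ≡⟨ cong₂ ℕ._+_ (q*oddPowerSum+1 j) (cong (q ^_) (sym (ℕ.*-suc 2 j))) ⟩
    evenPowerSum (suc j)                                ∎
    where
    open ≡-Reasoning
    t : ℕ
    t = q ^ suc (2 ℕ.* j)
    regroup : ∀ q s t → q ℕ.* (s ℕ.+ t) ℕ.+ 1 ≡ (q ℕ.* s ℕ.+ 1) ℕ.+ q ℕ.* t
    regroup = ℕ-Solver.solve-∀

module FiniteFieldProperties {q n : ℕ} (F : FiniteField q n) where

  open FiniteField F
  open IsCommutativeRing isCommutativeRing
    using (*-comm; *-assoc; *-identityˡ; *-identityʳ; zeroˡ; zeroʳ; +-identityʳ; -‿inverseʳ)

  commutativeRing : CommutativeRing _ _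
  commutativeRing = record { isCommutativeRing = isCommutativeRing }

  open CommutativeRing commutativeRing using (ring; commutativeSemiring; *-commutativeMonoid; *-commutativeSemigroup)
  open import Algebra.Properties.Ring ring using (-‿injective; -0#≈0#)
  open import Algebra.Properties.CommutativeSemigroup *-commutativeSemigroup using (x∙yz≈y∙xz)
  open import Algebra.Properties.CommutativeSemiring.Exp commutativeSemiring
    using (^-homo-*; ^-assocʳ; ^-distrib-*) renaming (_^_ to _^ᴿ_)

  open import Algebra.Solver.Ring.NaturalCoefficients.Default commutativeSemiring
    using (solve; _:+_; _:*_; _:=_)

  pow≗^ᴿ : ∀ x k → pow x k ≡ x ^ᴿ k
  pow≗^ᴿ x zero = refl
  pow≗^ᴿ x (suc k) = cong (x *_) (pow≗^ᴿ x k)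

  pow-+ : ∀ x k l → pow x (k ℕ.+ l) ≡ pow x k * pow x l
  pow-+ x k l rewrite pow≗^ᴿ x (k ℕ.+ l) | pow≗^ᴿ x k | pow≗^ᴿ x l = ^-homo-* x k l

  pow-* : ∀ x k l → pow x (k ℕ.* l) ≡ pow (pow x k) l
  pow-* x k l rewrite pow≗^ᴿ x (k ℕ.* l) | pow≗^ᴿ x k | pow≗^ᴿ (x ^ᴿ k) l = sym (^-assocʳ x k l)

  pow-distrib-* : ∀ x y k → pow (x * y) k ≡ pow x k * pow y k
  pow-distrib-* x y k rewrite pow≗^ᴿ (x * y) k | pow≗^ᴿ x k | pow≗^ᴿ y k = ^-distrib-* x y k

  pow-1# : ∀ k → pow 1# k ≡ 1#
  pow-1# zero = refl
  pow-1# (suc k) = trans (cong (1# *_) (pow-1# k)) (*-identityˡ 1#)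

  pow-0# : ∀ k → .{{NonZero k}} → pow 0# k ≡ 0#
  pow-0# (suc k) = zeroˡ _

  pow-suc-comm : ∀ x k → pow x (k ℕ.+ 1) ≡ pow x k * x
  pow-suc-comm x k = trans (pow-+ x k 1) (cong (pow x k *_) (*-identityʳ x))

  *-cancel-inverse : ∀ {x x⁻¹} → x⁻¹ * x ≡ 1# → ∀ y → x⁻¹ * (x * y) ≡ y
  *-cancel-inverse {x} {x⁻¹} x⁻¹x≡1 y = trans (sym (*-assoc x⁻¹ x y)) (trans (cong (_* y) x⁻¹x≡1) (*-identityˡ y))

  inverseˡ : ∀ {x} → x ≢ 0# → ∃ λ x⁻¹ → x⁻¹ * x ≡ 1#
  inverseˡ {x} x≢0 with hasInverse x x≢0
  ... | x⁻¹ , xx⁻¹≡1 = x⁻¹ , trans (*-comm x⁻¹ x) xx⁻¹≡1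

  *-cancelˡ : ∀ {x y z} → x ≢ 0# → x * y ≡ x * z → y ≡ z
  *-cancelˡ {x} {y} {z} x≢0 xy≡xz with inverseˡ x≢0
  ... | x⁻¹ , x⁻¹x≡1 = begin
    y             ≡⟨ sym (*-cancel-inverse x⁻¹x≡1 y) ⟩
    x⁻¹ * (x * y) ≡⟨ cong (x⁻¹ *_) xy≡xz ⟩
    x⁻¹ * (x * z) ≡⟨ *-cancel-inverse x⁻¹x≡1 z ⟩
    z             ∎
    where open ≡-Reasoning

  *-nonzero : ∀ {x y} → x ≢ 0# → y ≢ 0# → x * y ≢ 0#
  *-nonzero {x} x≢0 y≢0 xy≡0 = y≢0 (*-cancelˡ x≢0 (trans xy≡0 (sym (zeroʳ x))))

  pow-nonzero : ∀ {x} → x ≢ 0# → ∀ k → pow x k ≢ 0#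
  pow-nonzero x≢0 zero 1≡0 = 0≢1 (sym 1≡0)
  pow-nonzero x≢0 (suc k) = *-nonzero x≢0 (pow-nonzero x≢0 k)

  -‿nonzero : ∀ {x} → x ≢ 0# → - x ≢ 0#
  -‿nonzero x≢0 -x≡0 = x≢0 (-‿injective (trans -x≡0 (sym -0#≈0#)))

  from-injective : ∀ {k} (e : Fin k ↔ Carrier) {x y} → Inverse.from e x ≡ Inverse.from e y → x ≡ y
  from-injective e = Injection.injective (↔⇒↣ (↔-sym e))

  _≟_ : (x y : Carrier) → Dec (x ≡ y)
  x ≟ y with Inverse.from enumeration x Fin.≟ Inverse.from enumeration y
  ... | yes ix≡iy = yes (from-injective enumeration ix≡iy)
  ... | no ix≢iy = no (ix≢iy ∘ cong (Inverse.from enumeration))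

  zero-or-nonzero : ∀ {p} (P : Carrier → Set p) → P 0# → (∀ x → x ≢ 0# → P x) → ∀ x → P x
  zero-or-nonzero P P0 P≢0 x with x ≟ 0#
  ... | yes refl = P0
  ... | no x≢0 = P≢0 x x≢0

  ≢0-preimage : ∀ {h : Carrier → Carrier} → h 0# ≡ 0# → ∀ {x} → h x ≢ 0# → x ≢ 0#
  ≢0-preimage h0≡0 hx≢0 refl = hx≢0 h0≡0

  ifZero : Carrier → Carrier → Carrier → Carrier
  ifZero x y z with x ≟ 0#
  ... | yes _ = y
  ... | no _ = z

  ifZero-0# : ∀ y z → ifZero 0# y z ≡ y
  ifZero-0# y z with 0# ≟ 0#
  ... | yes _ = refl
  ... | no 0≢0 = ⊥-elim (0≢0 refl)

  ifZero-nonzero : ∀ {x} y z → x ≢ 0# → ifZero x y z ≡ z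
  ifZero-nonzero {x} y z x≢0 with x ≟ 0#
  ... | yes x≡0 = ⊥-elim (x≢0 x≡0)
  ... | no _ = refl

  open import Algebra.Properties.CommutativeMonoid.Sum *-commutativeMonoid
    using (sum-permute; sum-remove; ∑-distrib-+; sum-cong-≗) renaming (sum to ∏)

  ∏-nonzero : ∀ {k} (f : Fin k → Carrier) → (∀ i → f i ≢ 0#) → ∏ f ≢ 0#
  ∏-nonzero {zero} f f≢0 1≡0 = 0≢1 (sym 1≡0)
  ∏-nonzero {suc k} f f≢0 = *-nonzero (f≢0 Fin.zero) (∏-nonzero (f ∘ Fin.suc) (f≢0 ∘ Fin.suc))

  ∏-const : ∀ {k} (f : Fin k → Carrier) {x} → (∀ i → f i ≡ x) → ∏ f ≡ pow x k
  ∏-const {zero} f f≡x = refl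
  ∏-const {suc k} f f≡x = cong₂ _*_ (f≡x Fin.zero) (∏-const (f ∘ Fin.suc) (f≡x ∘ Fin.suc))

  *-↔ : ∀ {u} → u ≢ 0# → Carrier ↔ Carrier
  *-↔ {u} u≢0 with inverseˡ u≢0
  ... | u⁻¹ , u⁻¹u≡1 =
    mk↔ₛ′ (u *_) (u⁻¹ *_) (*-cancel-inverse (trans (*-comm u u⁻¹) u⁻¹u≡1)) (*-cancel-inverse u⁻¹u≡1)

  -- The nonzero elements are permuted by x ↦ u x; replacing 0 by 1 turns this into an
  -- identity of products which, after cancelling ∏ x, reads u ^ (|F| - 1) = 1.
  module _ {m : ℕ} (e : Fin (suc m) ↔ Carrier) {u : Carrier} (u≢0 : u ≢ 0#) where
    open Inverse e using (to; from; strictlyInverseˡ; strictlyInverseʳ)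

    nonzeroPart scale : Carrier → Carrier
    nonzeroPart x = ifZero x 1# x
    scale x = ifZero x 1# u

    nonzeroPart-* : ∀ x → nonzeroPart (u * x) ≡ scale x * nonzeroPart x
    nonzeroPart-* = zero-or-nonzero _ zero-case nonzero-case
      where
      open ≡-Reasoning
      zero-case : nonzeroPart (u * 0#) ≡ scale 0# * nonzeroPart 0#
      zero-case = begin
        nonzeroPart (u * 0#)      ≡⟨ cong nonzeroPart (zeroʳ u) ⟩
        nonzeroPart 0#            ≡⟨ ifZero-0# 1# 0# ⟩
        1#                        ≡⟨ sym (*-identityˡ 1#) ⟩
        1# * 1#                   ≡⟨ sym (cong₂ _*_ (ifZero-0# 1# u) (ifZero-0# 1# 0#)) ⟩
        scale 0# * nonzeroPart 0# ∎
      nonzero-case : ∀ x → x ≢ 0# → nonzeroPart (u * x) ≡ scale x * nonzeroPart x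
      nonzero-case x x≢0 = begin
        nonzeroPart (u * x)       ≡⟨ ifZero-nonzero 1# (u * x) (*-nonzero u≢0 x≢0) ⟩
        u * x                     ≡⟨ sym (cong₂ _*_ (ifZero-nonzero 1# u x≢0) (ifZero-nonzero 1# x x≢0)) ⟩
        scale x * nonzeroPart x   ∎

    ∏scale≡1 : ∏ (scale ∘ to) ≡ 1#
    ∏scale≡1 = *-cancelˡ P≢0 (begin
      P * ∏ (scale ∘ to)                           ≡⟨ *-comm P _ ⟩
      ∏ (scale ∘ to) * P                           ≡⟨ sym (∑-distrib-+ (scale ∘ to) (nonzeroPart ∘ to)) ⟩
      ∏ (λ i → scale (to i) * nonzeroPart (to i))  ≡⟨ sum-cong-≗ (sym ∘ nonzeroPart-* ∘ to) ⟩
      ∏ (λ i → nonzeroPart (u * to i))             ≡⟨ sum-cong-≗ (cong nonzeroPart ∘ sym ∘ strictlyInverseˡ ∘ (u *_) ∘ to) ⟩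
      ∏ (λ i → nonzeroPart (to (π ⟨$⟩ʳ i)))        ≡⟨ sym (sum-permute (nonzeroPart ∘ to) π) ⟩
      P                                            ≡⟨ sym (*-identityʳ P) ⟩
      P * 1#                                       ∎)
      where
      open ≡-Reasoning
      π : Permutation (suc m) (suc m)
      π = ↔-sym e ↔-∘ (*-↔ u≢0 ↔-∘ e)
      P : Carrier
      P = ∏ (nonzeroPart ∘ to)
      P≢0 : P ≢ 0#
      P≢0 = ∏-nonzero (nonzeroPart ∘ to) (λ i → nonzeroPart≢0 (to i))
        where
        nonzeroPart≢0 : ∀ x → nonzeroPart x ≢ 0#
        nonzeroPart≢0 x with x ≟ 0#
        ... | yes _ = λ 1≡0 → 0≢1 (sym 1≡0)
        ... | no x≢0 = x≢0

    ∏scale≡pow : ∏ (scale ∘ to) ≡ pow u m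
    ∏scale≡pow = begin
      ∏ (scale ∘ to)                                          ≡⟨ sum-remove {i = from 0#} (scale ∘ to) ⟩
      scale (to (from 0#)) * ∏ (scale ∘ to ∘ Fin.punchIn (from 0#)) ≡⟨ cong₂ _*_ scale-0 (∏-const _ scale-rest) ⟩
      1# * pow u m                                            ≡⟨ *-identityˡ _ ⟩
      pow u m                                                 ∎
      where
      open ≡-Reasoning
      scale-0 : scale (to (from 0#)) ≡ 1#
      scale-0 = trans (cong scale (strictlyInverseˡ 0#)) (ifZero-0# 1# u)
      scale-rest : ∀ j → scale (to (Fin.punchIn (from 0#) j)) ≡ u
      scale-rest j = ifZero-nonzero 1# u λ x≡0 →
        Fin.punchInᵢ≢i (from 0#) j (trans (sym (strictlyInverseʳ _)) (cong from x≡0))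

    pow-unit-size : pow u (suc m) ≡ u
    pow-unit-size = trans (cong (u *_) (trans (sym ∏scale≡pow) ∏scale≡1)) (*-identityʳ u)

  pow-card : ∀ {k} → Fin k ↔ Carrier → ∀ x → pow x k ≡ x
  pow-card {zero} e x with Inverse.from e x
  ... | ()
  pow-card {suc k} e = zero-or-nonzero _ (zeroˡ _) (λ _ → pow-unit-size e)

  pow-size : ∀ x → pow x (q ^ n) ≡ x
  pow-size = pow-card enumeration

  pow-+size : ∀ x k → pow x (k ℕ.+ q ^ n) ≡ pow x k * x
  pow-+size x k = trans (pow-+ x k (q ^ n)) (cong (pow x k *_) (pow-size x))

  fin1-irrelevant : (i j : Fin 1) → i ≡ j
  fin1-irrelevant Fin.zero Fin.zero = refl

  size≥3⊎nonzero≡1 : ∀ {k} → Fin k ↔ Carrier → 3 ≤ k ⊎ (∀ x → x ≢ 0# → x ≡ 1#)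
  size≥3⊎nonzero≡1 {0} e with Inverse.from e 0#
  ... | ()
  size≥3⊎nonzero≡1 {1} e = ⊥-elim (0≢1 (from-injective e (fin1-irrelevant _ _)))
  size≥3⊎nonzero≡1 {2} e = inj₂ λ x x≢0 → from-injective e
    (Fin.punchOut-injective (x≢0 ∘ sym ∘ from-injective e) (0≢1 ∘ from-injective e) (fin1-irrelevant _ _))
  size≥3⊎nonzero≡1 {suc (suc (suc k))} e = inj₁ (ℕ.s≤s (ℕ.s≤s (ℕ.s≤s ℕ.z≤n)))

  prodF-1# : ∀ k (f : ℕ → Carrier) → (∀ i → f i ≡ 1#) → prodF k f ≡ 1#
  prodF-1# zero f f≡1 = refl
  prodF-1# (suc k) f f≡1 = trans (cong₂ _*_ (prodF-1# k f f≡1) (f≡1 k)) (*-identityˡ 1#)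

  3≤size : ∀ {a} → a ≢ 0# → prodF n (λ i → pow (- a) (q ^ i)) ≢ 1# → 3 ≤ q ^ n
  3≤size {a} a≢0 norm≢1 with size≥3⊎nonzero≡1 enumeration
  ... | inj₁ 3≤q^n = 3≤q^n
  ... | inj₂ nonzero≡1 = ⊥-elim (norm≢1 (prodF-1# n _ λ i →
          trans (cong (λ t → pow t (q ^ i)) (nonzero≡1 (- a) (-‿nonzero a≢0))) (pow-1# (q ^ i))))

  module Reciprocal (3≤size : 3 ≤ q ^ n) where

    x*inv-x : ∀ {x} → x ≢ 0# → x * inv x ≡ 1#
    x*inv-x {x} x≢0 = *-cancelˡ x≢0 (begin
      x * (x * inv x) ≡⟨ cong (pow x) (ℕ.m+[n∸m]≡n (ℕ.≤-trans (ℕ.n≤1+n 2) 3≤size)) ⟩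
      pow x (q ^ n)   ≡⟨ pow-size x ⟩
      x               ≡⟨ sym (*-identityʳ x) ⟩
      x * 1#          ∎)
      where open ≡-Reasoning

    *-inv-cancelʳ : ∀ {x} y → x ≢ 0# → (y * x) * inv x ≡ y
    *-inv-cancelʳ {x} y x≢0 = trans (*-assoc y x (inv x)) (trans (cong (y *_) (x*inv-x x≢0)) (*-identityʳ y))

    inv-0# : inv 0# ≡ 0#
    inv-0# = pow-0# (q ^ n ∸ 2) {{ℕ.>-nonZero (ℕ.∸-monoˡ-≤ 2 3≤size)}}

    inv-nonzero : ∀ {x} → x ≢ 0# → inv x ≢ 0#
    inv-nonzero x≢0 = pow-nonzero x≢0 (q ^ n ∸ 2)

    inv-pow : ∀ x k → inv (pow x k) ≡ pow (inv x) k
    inv-pow x k = begin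
      pow (pow x k) (q ^ n ∸ 2) ≡⟨ sym (pow-* x k (q ^ n ∸ 2)) ⟩
      pow x (k ℕ.* (q ^ n ∸ 2)) ≡⟨ cong (pow x) (ℕ.*-comm k (q ^ n ∸ 2)) ⟩
      pow x ((q ^ n ∸ 2) ℕ.* k) ≡⟨ pow-* x (q ^ n ∸ 2) k ⟩
      pow (inv x) k             ∎
      where open ≡-Reasoning

  module Frobenius (Q : ℕ) (Q*q≡size : Q ℕ.* q ≡ q ^ n) where

    pow-Q-q : ∀ x → pow (pow x Q) q ≡ x
    pow-Q-q x = trans (sym (pow-* x Q q)) (trans (cong (pow x) Q*q≡size) (pow-size x))

    pow-q-Q : ∀ x → pow (pow x q) Q ≡ x
    pow-q-Q x = trans (sym (pow-* x q Q)) (trans (cong (pow x) (trans (ℕ.*-comm q Q) Q*q≡size)) (pow-size x))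

    pow-q-injective : ∀ {x y} → pow x q ≡ pow y q → x ≡ y
    pow-q-injective {x} {y} xᵠ≡yᵠ = trans (sym (pow-q-Q x)) (trans (cong (λ t → pow t Q) xᵠ≡yᵠ) (pow-q-Q y))

    pow-Q-fixed : ∀ {x} → pow x q ≡ x → pow x Q ≡ x
    pow-Q-fixed {x} xᵠ≡x = pow-q-injective (trans (pow-Q-q x) (sym xᵠ≡x))

  module Inversion (3≤size : 3 ≤ q ^ n) (Q : ℕ) (Q*q≡size : Q ℕ.* q ≡ q ^ n) (r s : ℕ)
                   (q*r≡s+size : q ℕ.* r ≡ s ℕ.+ q ^ n) (q*s+1≡r : q ℕ.* s ℕ.+ 1 ≡ r) where
    open Reciprocal 3≤size
    open Frobenius Q Q*q≡size

    N M : ℕ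
    N = q ^ n
    M = r ℕ.+ s

    q*r+[q*s+1]≡M+N : q ℕ.* r ℕ.+ (q ℕ.* s ℕ.+ 1) ≡ M ℕ.+ N
    q*r+[q*s+1]≡M+N = trans (cong₂ ℕ._+_ q*r≡s+size q*s+1≡r) (regroup s N r)
      where
      regroup : ∀ s N r → s ℕ.+ N ℕ.+ r ≡ r ℕ.+ s ℕ.+ N
      regroup = ℕ-Solver.solve-∀

    [q+1]*r≡M+N : (q ℕ.+ 1) ℕ.* r ≡ M ℕ.+ N
    [q+1]*r≡M+N = begin
      (q ℕ.+ 1) ℕ.* r               ≡⟨ distrib q r ⟩
      q ℕ.* r ℕ.+ r                 ≡⟨ cong (q ℕ.* r ℕ.+_) (sym q*s+1≡r) ⟩
      q ℕ.* r ℕ.+ (q ℕ.* s ℕ.+ 1)   ≡⟨ q*r+[q*s+1]≡M+N ⟩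
      M ℕ.+ N                       ∎
      where
      open ≡-Reasoning
      distrib : ∀ q r → (q ℕ.+ 1) ℕ.* r ≡ q ℕ.* r ℕ.+ r
      distrib = ℕ-Solver.solve-∀

    M*q+1≡M+N : M ℕ.* q ℕ.+ 1 ≡ M ℕ.+ N
    M*q+1≡M+N = trans (distrib r s q) q*r+[q*s+1]≡M+N
      where
      distrib : ∀ r s q → (r ℕ.+ s) ℕ.* q ℕ.+ 1 ≡ q ℕ.* r ℕ.+ (q ℕ.* s ℕ.+ 1)
      distrib = ℕ-Solver.solve-∀

    [q+1]*s+1≡M : (q ℕ.+ 1) ℕ.* s ℕ.+ 1 ≡ M
    [q+1]*s+1≡M = trans (distrib q s) (cong (ℕ._+ s) q*s+1≡r)
      where
      distrib : ∀ q s → (q ℕ.+ 1) ℕ.* s ℕ.+ 1 ≡ q ℕ.* s ℕ.+ 1 ℕ.+ s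
      distrib = ℕ-Solver.solve-∀

    pow-r-q : ∀ z → pow (pow z r) q ≡ pow z s * z
    pow-r-q z = begin
      pow (pow z r) q ≡⟨ sym (pow-* z r q) ⟩
      pow z (r ℕ.* q) ≡⟨ cong (pow z) (trans (ℕ.*-comm r q) q*r≡s+size) ⟩
      pow z (s ℕ.+ N) ≡⟨ pow-+size z s ⟩
      pow z s * z     ∎
      where open ≡-Reasoning

    pow-r-Q : ∀ z → pow (pow z r) Q ≡ pow z s * pow z Q
    pow-r-Q z = pow-q-injective (begin
      pow (pow (pow z r) Q) q               ≡⟨ pow-Q-q (pow z r) ⟩
      pow z r                               ≡⟨ cong (pow z) (sym q*s+1≡r) ⟩
      pow z (q ℕ.* s ℕ.+ 1)                 ≡⟨ pow-suc-comm z (q ℕ.* s) ⟩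
      pow z (q ℕ.* s) * z                   ≡⟨ cong₂ _*_ (trans (cong (pow z) (ℕ.*-comm q s)) (pow-* z s q)) (sym (pow-Q-q z)) ⟩
      pow (pow z s) q * pow (pow z Q) q     ≡⟨ sym (pow-distrib-* (pow z s) (pow z Q) q) ⟩
      pow (pow z s * pow z Q) q             ∎)
      where open ≡-Reasoning

    module NonzeroPoint {x : Carrier} (x≢0 : x ≢ 0#) where

      c d : Carrier
      c = inv x
      d = pow c M

      x*c≡1 : x * c ≡ 1#
      x*c≡1 = x*inv-x x≢0

      d-fixed : pow d q ≡ d
      d-fixed = *-cancelˡ (inv-nonzero x≢0) (begin
        c * pow d q               ≡⟨ *-comm c _ ⟩
        pow d q * c               ≡⟨ cong (_* c) (sym (pow-* c M q)) ⟩
        pow c (M ℕ.* q) * c       ≡⟨ sym (pow-suc-comm c (M ℕ.* q)) ⟩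
        pow c (M ℕ.* q ℕ.+ 1)     ≡⟨ cong (pow c) M*q+1≡M+N ⟩
        pow c (M ℕ.+ N)           ≡⟨ pow-+size c M ⟩
        d * c                     ≡⟨ *-comm d c ⟩
        c * d                     ∎)
        where open ≡-Reasoning

      x*c^[[q+1]r]≡d : x * pow c ((q ℕ.+ 1) ℕ.* r) ≡ d
      x*c^[[q+1]r]≡d = begin
        x * pow c ((q ℕ.+ 1) ℕ.* r) ≡⟨ cong (λ k → x * pow c k) [q+1]*r≡M+N ⟩
        x * pow c (M ℕ.+ N)         ≡⟨ cong (x *_) (pow-+size c M) ⟩
        x * (d * c)                 ≡⟨ x∙yz≈y∙xz x d c ⟩
        d * (x * c)                 ≡⟨ cong (d *_) x*c≡1 ⟩
        d * 1#                      ≡⟨ *-identityʳ d ⟩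
        d                           ∎
        where open ≡-Reasoning

      c^[[q+1]s]≡d*x : pow c ((q ℕ.+ 1) ℕ.* s) ≡ d * x
      c^[[q+1]s]≡d*x = sym (begin
        d * x                              ≡⟨ cong (λ k → pow c k * x) (sym [q+1]*s+1≡M) ⟩
        pow c ((q ℕ.+ 1) ℕ.* s ℕ.+ 1) * x  ≡⟨ cong (_* x) (pow-suc-comm c ((q ℕ.+ 1) ℕ.* s)) ⟩
        (pow c ((q ℕ.+ 1) ℕ.* s) * c) * x  ≡⟨ *-assoc _ c x ⟩
        pow c ((q ℕ.+ 1) ℕ.* s) * (c * x)  ≡⟨ cong (pow c ((q ℕ.+ 1) ℕ.* s) *_) (trans (*-comm c x) x*c≡1) ⟩
        pow c ((q ℕ.+ 1) ℕ.* s) * 1#       ≡⟨ *-identityʳ _ ⟩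
        pow c ((q ℕ.+ 1) ℕ.* s)            ∎)
        where open ≡-Reasoning

      d*x^s≡c^r : d * pow x s ≡ pow c r
      d*x^s≡c^r = begin
        d * pow x s                     ≡⟨ cong (_* pow x s) (pow-+ c r s) ⟩
        (pow c r * pow c s) * pow x s   ≡⟨ *-assoc _ _ _ ⟩
        pow c r * (pow c s * pow x s)   ≡⟨ cong (pow c r *_) (sym (pow-distrib-* c x s)) ⟩
        pow c r * pow (c * x) s         ≡⟨ cong (λ t → pow c r * pow t s) (trans (*-comm c x) x*c≡1) ⟩
        pow c r * pow 1# s              ≡⟨ cong (pow c r *_) (pow-1# s) ⟩
        pow c r * 1#                    ≡⟨ *-identityʳ _ ⟩
        pow c r                         ∎
        where open ≡-Reasoning

    pow-*-inv-pow : ∀ z x k l → pow (z * inv (pow x k)) l ≡ pow z l * pow (inv x) (k ℕ.* l)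
    pow-*-inv-pow z x k l = begin
      pow (z * inv (pow x k)) l              ≡⟨ pow-distrib-* z (inv (pow x k)) l ⟩
      pow z l * pow (inv (pow x k)) l        ≡⟨ cong (λ t → pow z l * pow t l) (inv-pow x k) ⟩
      pow z l * pow (pow (inv x) k) l        ≡⟨ cong (pow z l *_) (sym (pow-* (inv x) k l)) ⟩
      pow z l * pow (inv x) (k ℕ.* l)        ∎
      where open ≡-Reasoning

    *-inv-pow-0# : ∀ y k → y * inv (pow 0# (k ℕ.+ 1)) ≡ 0#
    *-inv-pow-0# y k = begin
      y * inv (pow 0# (k ℕ.+ 1))  ≡⟨ cong (λ t → y * inv t) (trans (pow-suc-comm 0# k) (zeroʳ _)) ⟩
      y * inv 0#                  ≡⟨ cong (y *_) inv-0# ⟩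
      y * 0#                      ≡⟨ zeroʳ y ⟩
      0#                          ∎
      where open ≡-Reasoning

    Q*q-nonZero : NonZero (Q ℕ.* q)
    Q*q-nonZero = subst NonZero (sym Q*q≡size) (ℕ.>-nonZero (ℕ.≤-trans (ℕ.s≤s ℕ.z≤n) 3≤size))

    module _ (a : Carrier) where

      φ ψ : Carrier → Carrier
      φ z = pow z Q + a * z
      ψ w = pow w Q + a * pow w q

      pow-Q-0# : pow 0# Q ≡ 0#
      pow-Q-0# = pow-0# Q {{ℕ.m*n≢0⇒m≢0 Q {{Q*q-nonZero}}}}

      φ-0# : φ 0# ≡ 0#
      φ-0# = trans (cong₂ _+_ pow-Q-0# (zeroʳ a)) (+-identityʳ 0#)

      ψ-0# : ψ 0# ≡ 0#
      ψ-0# = trans (cong₂ _+_ pow-Q-0# (trans (cong (a *_) pow-q-0#) (zeroʳ a))) (+-identityʳ 0#)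
        where
        pow-q-0# : pow 0# q ≡ 0#
        pow-q-0# = pow-0# q {{ℕ.m*n≢0⇒n≢0 Q {{Q*q-nonZero}}}}

      ψ-twist : ∀ z {d} → pow d q ≡ d → ψ (pow z r * d) ≡ pow z s * (d * φ z)
      ψ-twist z {d} d-fixed = begin
        ψ (pow z r * d)
          ≡⟨ cong₂ (λ u v → u + a * v) (pow-distrib-* (pow z r) d Q) (pow-distrib-* (pow z r) d q) ⟩
        pow (pow z r) Q * pow d Q + a * (pow (pow z r) q * pow d q)
          ≡⟨ cong₂ (λ u v → u + a * v) (cong₂ _*_ (pow-r-Q z) (pow-Q-fixed d-fixed)) (cong₂ _*_ (pow-r-q z) d-fixed) ⟩
        (pow z s * pow z Q) * d + a * ((pow z s * z) * d)
          ≡⟨ factor (pow z s) (pow z Q) z d a ⟩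
        pow z s * (d * φ z)
          ∎
        where
        open ≡-Reasoning
        factor : ∀ S Z' Z D A → (S * Z') * D + A * ((S * Z) * D) ≡ S * (D * (Z' + A * Z))
        factor = solve 5 (λ S Z' Z D A → (S :* Z') :* D :+ A :* ((S :* Z) :* D) := S :* (D :* (Z' :+ A :* Z))) refl

      φ-twist : ∀ w {d} → pow d q ≡ d → φ (pow w (q ℕ.+ 1) * d) ≡ w * (d * ψ w)
      φ-twist w {d} d-fixed = begin
        φ (pow w (q ℕ.+ 1) * d)                              ≡⟨ cong (λ t → φ (t * d)) (pow-suc-comm w q) ⟩
        pow ((pow w q * w) * d) Q + a * ((pow w q * w) * d)  ≡⟨ cong (_+ a * ((pow w q * w) * d)) pow-Q ⟩
        (pow w Q * w) * d + a * ((pow w q * w) * d)          ≡⟨ factor w (pow w Q) (pow w q) d a ⟩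
        w * (d * ψ w)                                        ∎
        where
        open ≡-Reasoning
        pow-Q : pow ((pow w q * w) * d) Q ≡ (pow w Q * w) * d
        pow-Q = begin
          pow ((pow w q * w) * d) Q               ≡⟨ pow-distrib-* (pow w q * w) d Q ⟩
          pow (pow w q * w) Q * pow d Q           ≡⟨ cong₂ _*_ (pow-distrib-* (pow w q) w Q) (pow-Q-fixed d-fixed) ⟩
          (pow (pow w q) Q * pow w Q) * d         ≡⟨ cong (λ t → (t * pow w Q) * d) (pow-q-Q w) ⟩
          (w * pow w Q) * d                       ≡⟨ cong (_* d) (*-comm w (pow w Q)) ⟩
          (pow w Q * w) * d                       ∎
        factor : ∀ W WQ Wq D A → (WQ * W) * D + A * ((Wq * W) * D) ≡ W * (D * (WQ + A * Wq))
        factor = solve 5 (λ W WQ Wq D A → (WQ :* W) :* D :+ A :* ((Wq :* W) :* D) := W :* (D :* (WQ :+ A :* Wq))) refl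

      module _ (L ℓ : Carrier → Carrier) (L-inv : IsInverseOf L φ) (ℓ-inv : IsInverseOf ℓ ψ) where

        f g : Carrier → Carrier
        f x = L x * inv (pow x (q ℕ.+ 1))
        g x = ℓ (pow x s) * inv (pow x r)

        f-0# : f 0# ≡ 0#
        f-0# = *-inv-pow-0# (L 0#) q

        g-0# : g 0# ≡ 0#
        g-0# = subst (λ k → ℓ (pow 0# s) * inv (pow 0# k) ≡ 0#) q*s+1≡r (*-inv-pow-0# (ℓ (pow 0# s)) (q ℕ.* s))

        g∘f-nonzero : ∀ {x} → x ≢ 0# → g (f x) ≡ x
        g∘f-nonzero {x} x≢0 = begin
          ℓ (pow y s) * inv (pow y r)           ≡⟨ cong (λ t → ℓ t * inv (pow y r)) (sym ψ[x*y^r]≡y^s) ⟩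
          ℓ (ψ (x * pow y r)) * inv (pow y r)   ≡⟨ cong (_* inv (pow y r)) (proj₁ ℓ-inv (x * pow y r)) ⟩
          (x * pow y r) * inv (pow y r)         ≡⟨ *-inv-cancelʳ x (pow-nonzero y≢0 r) ⟩
          x                                     ∎
          where
          open ≡-Reasoning
          open NonzeroPoint x≢0
          z y : Carrier
          z = L x
          y = f x
          φz≡x : φ z ≡ x
          φz≡x = proj₂ L-inv x
          y≢0 : y ≢ 0#
          y≢0 = *-nonzero (≢0-preimage {φ} φ-0# (subst (_≢ 0#) (sym φz≡x) x≢0))
                          (inv-nonzero (pow-nonzero x≢0 (q ℕ.+ 1)))
          ψ[x*y^r]≡y^s : ψ (x * pow y r) ≡ pow y s
          ψ[x*y^r]≡y^s = begin
            ψ (x * pow y r)                              ≡⟨ cong (λ t → ψ (x * t)) (pow-*-inv-pow z x (q ℕ.+ 1) r) ⟩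
            ψ (x * (pow z r * pow c ((q ℕ.+ 1) ℕ.* r)))  ≡⟨ cong ψ (x∙yz≈y∙xz x (pow z r) _) ⟩
            ψ (pow z r * (x * pow c ((q ℕ.+ 1) ℕ.* r)))  ≡⟨ cong (λ t → ψ (pow z r * t)) x*c^[[q+1]r]≡d ⟩
            ψ (pow z r * d)                              ≡⟨ ψ-twist z d-fixed ⟩
            pow z s * (d * φ z)                          ≡⟨ cong (λ t → pow z s * (d * t)) φz≡x ⟩
            pow z s * (d * x)                            ≡⟨ cong (pow z s *_) (sym c^[[q+1]s]≡d*x) ⟩
            pow z s * pow c ((q ℕ.+ 1) ℕ.* s)            ≡⟨ sym (pow-*-inv-pow z x (q ℕ.+ 1) s) ⟩
            pow y s                                      ∎

        f∘g-nonzero : ∀ {x} → x ≢ 0# → f (g x) ≡ x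
        f∘g-nonzero {x} x≢0 = begin
          L G * inv (pow G (q ℕ.+ 1))                          ≡⟨ cong (λ t → L t * inv (pow G (q ℕ.+ 1))) (sym φ[x*G^[q+1]]≡G) ⟩
          L (φ (x * pow G (q ℕ.+ 1))) * inv (pow G (q ℕ.+ 1))  ≡⟨ cong (_* inv (pow G (q ℕ.+ 1))) (proj₁ L-inv (x * pow G (q ℕ.+ 1))) ⟩
          (x * pow G (q ℕ.+ 1)) * inv (pow G (q ℕ.+ 1))        ≡⟨ *-inv-cancelʳ x (pow-nonzero G≢0 (q ℕ.+ 1)) ⟩
          x                                                    ∎
          where
          open ≡-Reasoning
          open NonzeroPoint x≢0
          w G : Carrier
          w = ℓ (pow x s)
          G = g x
          ψw≡x^s : ψ w ≡ pow x s
          ψw≡x^s = proj₂ ℓ-inv (pow x s)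
          G≢0 : G ≢ 0#
          G≢0 = *-nonzero (≢0-preimage {ψ} ψ-0# (subst (_≢ 0#) (sym ψw≡x^s) (pow-nonzero x≢0 s)))
                          (inv-nonzero (pow-nonzero x≢0 r))
          φ[x*G^[q+1]]≡G : φ (x * pow G (q ℕ.+ 1)) ≡ G
          φ[x*G^[q+1]]≡G = begin
            φ (x * pow G (q ℕ.+ 1))                                ≡⟨ cong (λ t → φ (x * t)) (pow-*-inv-pow w x r (q ℕ.+ 1)) ⟩
            φ (x * (pow w (q ℕ.+ 1) * pow c (r ℕ.* (q ℕ.+ 1))))    ≡⟨ cong φ (x∙yz≈y∙xz x (pow w (q ℕ.+ 1)) _) ⟩
            φ (pow w (q ℕ.+ 1) * (x * pow c (r ℕ.* (q ℕ.+ 1))))    ≡⟨ cong (λ k → φ (pow w (q ℕ.+ 1) * (x * pow c k))) (ℕ.*-comm r (q ℕ.+ 1)) ⟩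
            φ (pow w (q ℕ.+ 1) * (x * pow c ((q ℕ.+ 1) ℕ.* r)))    ≡⟨ cong (λ t → φ (pow w (q ℕ.+ 1) * t)) x*c^[[q+1]r]≡d ⟩
            φ (pow w (q ℕ.+ 1) * d)                                ≡⟨ φ-twist w d-fixed ⟩
            w * (d * ψ w)                                          ≡⟨ cong (λ t → w * (d * t)) ψw≡x^s ⟩
            w * (d * pow x s)                                      ≡⟨ cong (w *_) d*x^s≡c^r ⟩
            w * pow c r                                            ≡⟨ cong (w *_) (sym (inv-pow x r)) ⟩
            G                                                      ∎

        inverse : IsInverseOf g f
        inverse = zero-or-nonzero _ (trans (cong g f-0#) g-0#) (λ _ → g∘f-nonzero)
                , zero-or-nonzero _ (trans (cong f g-0#) f-0#) (λ _ → f∘g-nonzero)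

mainTheorem4 : (p k q n : ℕ) → Prime p → 1 ≤ k → q ≡ p ^ k →
    (m : ℕ) → n ≡ suc (2 ℕ.* m) →
    (F : FiniteField q n) →
    let open FiniteField F
        r = sumℕ (suc ((n ∸ 1) / 2)) (λ i → q ^ (2 ℕ.* i))
        s = sumℕ ((n ∸ 1) / 2) (λ j → q ^ (2 ℕ.* j ℕ.+ 1))
    in (a : Carrier) → a ≢ 0# →
       prodF n (λ i → pow (- a) (q ^ i)) ≢ 1# →
       (L ℓ : Carrier → Carrier) →
       IsInverseOf L (λ x → pow x (q ^ (n ∸ 1)) + a * x) →
       IsInverseOf ℓ (λ x → pow x (q ^ (n ∸ 1)) + a * pow x q) →
       IsInverseOf (λ x → ℓ (pow x s) * inv (pow x r))
                   (λ x → L x * inv (pow x (q ℕ.+ 1)))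
mainTheorem4 _ _ q .(suc (2 ℕ.* m)) _ _ _ m refl F a a≢0 norm≢1 L ℓ L-inv ℓ-inv =
  Inversion.inverse (3≤size a≢0 norm≢1) (q ^ (2 ℕ.* m)) (ℕ.*-comm (q ^ (2 ℕ.* m)) q)
    (evenPowerSum q j) (oddPowerSum q j) q*r≡s+size (q*oddPowerSum+1 q j) a L ℓ L-inv ℓ-inv
  where
  open FiniteFieldProperties F
  j : ℕ
  j = (2 ℕ.* m) / 2
  q*r≡s+size : q ℕ.* evenPowerSum q j ≡ oddPowerSum q j ℕ.+ q ^ suc (2 ℕ.* m)
  q*r≡s+size = subst (λ t → q ℕ.* evenPowerSum q j ≡ oddPowerSum q j ℕ.+ q ^ suc (2 ℕ.* t))
                     (half-double m) (q*evenPowerSum q j)
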